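{- Let $A$ be a type and $t$ a closed $\lambda\mu$-term. If $\vdash t:A$, then $t\in|A|$.
   Context: $\lambda\mu$-terms: fix two disjoint infinite sets of variables, the $\lambda$-variables and the $\mu$-variables. Terms: $t ::= x \mid \lambda x.t \mid (t\,t) \mid \mu\alpha.t \mid (\alpha\,t)$ ($\lambda x$, $\mu\alpha$ binders). $u[\alpha:=^*v]$ replaces inductively each subterm $(\alpha\,w)$ of $u$ by $(\alpha\,(w\,v))$. Reduction $\triangleright$ is the compatible closure of $(\lambda x.u\;v)\triangleright u[x:=v]$ and $(\mu\alpha.u\;v)\triangleright \mu\alpha.u[\alpha:=^*v]$; $\triangleright^*$ its reflexive transitive closure. For a finite sequence $\bar u=u_1\dots u_n$, $(t\,\bar u)=(\dots(t\,u_1)\dots u_n)$, $(t\,\emptyset)=t$; $\mathcal T$ is the set of terms, $\mathcal T^{<\omega}$ the set of finite sequences of terms. Types: $A ::= X\mid\perp\mid A\to A$ ($X$ in an infinite set $\mathcal P$ of propositional variables). Typing rules for $\Gamma\vdash t:A;\Delta$ ($\Gamma$: declarations $x:A$; $\Delta$: declarations $\alpha:B$): (ax) $\Gamma\vdash x:A;\Delta$ if $x:A\in\Gamma$; ($\to_i$) from $\Gamma,x:A\vdash t:B;\Delta$ infer $\Gamma\vdash\lambda x.t:A\to B;\Delta$; ($\to_e$) from $\Gamma\vdash u:A\to B;\Delta$ and $\Gamma\vdash v:A;\Delta$ infer $\Gamma\vdash(u\,v):B;\Delta$; ($\mu$) from $\Gamma\vdash t:\perp;\Delta,\alpha:A$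 infer $\Gamma\vdash\mu\alpha.t:A;\Delta$; ($\perp$) from $\Gamma\vdash t:A;\Delta,\alpha:A$ infer $\Gamma\vdash(\alpha\,t):\perp;\Delta,\alpha:A$. $\vdash t:A$ means empty contexts. Semantics: a set $\mathcal S$ of terms is saturated if $v\triangleright^*u$ and $u\in\mathcal S$ imply $v\in\mathcal S$. $\mathcal K\leadsto\mathcal L=\{t\mid\forall u\in\mathcal K,(t\,u)\in\mathcal L\}$ for sets of terms; for $\mathcal X\subseteq\mathcal T^{<\omega}$, $\mathcal X\leadsto\mathcal L=\{t\mid\forall\bar u\in\mathcal X,(t\,\bar u)\in\mathcal L\}$. A model $\mathcal M=\langle(\mathcal C_i)_{i\in I},(\mathcal B_i)_{i\in I},(R_j)_{j\in J}\rangle$: $I,J\subseteq\mathbb N$, $0\in I$, the $\mathcal C_i$ pairwise disjoint infinite sets of $\mu$-variables, the $\mathcal B_i,R_j$ non-empty saturated sets of terms, such that for all $i\in I$: if $\alpha\in\mathcal C_i$ and $u\in\mathcal B_0$ then $\mu\alpha.u\in\mathcal B_i$; if $\alpha\in\mathcal C_i$ and $u\in\mathcal B_i$ then $(\alpha\,u)\in\mathcal B_0$; and for each $j\in J$ there are $i\in I$, $\mathcal X_j\subseteq\mathcal T^{<\omega}$ with $R_j=\mathcal X_j\leadsto\mathcal B_i$. $|\mathcal M|$ is the smallest set containing all $\mathcal B_i,R_j$ and closed under $\leadsto$. An $\mathcal M$-interpretation is $\mathcal I:\mathcal P\to|\mathcal M|$ extended by $\mathcal I(\perp)=\mathcal B_0$,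 $\mathcal I(A\to B)=\mathcal I(A)\leadsto\mathcal I(B)$. $|A|_{\mathcal M}=\bigcap_{\mathcal I}\mathcal I(A)$ over all $\mathcal M$-interpretations, and $|A|=\bigcap_{\mathcal M}|A|_{\mathcal M}$ over all models. -}

module Defs where

open import Level using (0ℓ)
open import Data.Nat using (ℕ; zero; suc; _≤_)
open import Data.Fin using (Fin; zero; suc)
open import Data.List using (List; foldl)
open import Data.Vec using (Vec; lookup; _∷_)
open import Data.Product using (Σ; ∃; _×_)
open import Relation.Unary using (Pred)
open import Relation.Nullary using (yes; no)
open import Relation.Binary.PropositionalEquality using (_≡_)
open import Relation.Binary.Construct.Closure.ReflexiveTransitive using (Star)
import Data.Nat as N
import Data.Fin as F

-- λμ-terms, locally nameless with well-scoped bound indices.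
-- Tm n m : terms with at most n enclosing λ-binders and m enclosing
-- μ-binders.  Free λ-variables / free μ-variables are names in ℕ
-- (two disjoint sorts by construction).  Term = Tm 0 0 are the
-- (locally closed) λμ-terms.

data Tm (n m : ℕ) : Set where
  fv  : ℕ → Tm n m
  bv  : Fin n → Tm n m
  lam : Tm (suc n) m → Tm n m
  app : Tm n m → Tm n m → Tm n m
  mu  : Tm n (suc m) → Tm n m
  nfv : ℕ → Tm n m → Tm n m         -- (α t), α a free μ-variable
  nbv : Fin m → Tm n m → Tm n m     -- (α t), α a bound μ-variable

Term : Set
Term = Tm 0 0

ext : ∀ {n n'} → (Fin n → Fin n') → Fin (suc n) → Fin (suc n')
ext ρ zero    = zero
ext ρ (suc i) = suc (ρ i)

ren : ∀ {n n' m m'} → (Fin n → Fin n') → (Fin m → Fin m') → Tm n m → Tm n' m'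
ren ρ τ (fv x)    = fv x
ren ρ τ (bv i)    = bv (ρ i)
ren ρ τ (lam t)   = lam (ren (ext ρ) τ t)
ren ρ τ (app t u) = app (ren ρ τ t) (ren ρ τ u)
ren ρ τ (mu t)    = mu (ren ρ (ext τ) t)
ren ρ τ (nfv α t) = nfv α (ren ρ τ t)
ren ρ τ (nbv α t) = nbv (τ α) (ren ρ τ t)

idF : ∀ {n} → Fin n → Fin n
idF i = i

exts : ∀ {n n' m} → (Fin n → Tm n' m) → Fin (suc n) → Tm (suc n') m
exts σ zero    = bv zero
exts σ (suc i) = ren suc idF (σ i)

sub : ∀ {n n' m} → (Fin n → Tm n' m) → Tm n m → Tm n' m
sub σ (fv x)    = fv x
sub σ (bv i)    = σ i
sub σ (lam t)   = lam (sub (exts σ) t)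
sub σ (app t u) = app (sub σ t) (sub σ u)
sub σ (mu t)    = mu (sub (λ i → ren idF suc (σ i)) t)
sub σ (nfv α t) = nfv α (sub σ t)
sub σ (nbv α t) = nbv α (sub σ t)

subst0 : ∀ {n m} → Tm (suc n) m → Tm n m → Tm n m
subst0 {n} {m} u v = sub σ u
  where
  σ : Fin (suc n) → Tm n m
  σ zero    = v
  σ (suc i) = bv i

-- u[α:=* v] for a bound μ-variable α (index k): every subterm (α w)
-- is replaced (inductively) by (α (w v)).
appμ : ∀ {n m} → Fin m → Tm n m → Tm n m → Tm n m
appμ k (fv x)    v = fv x
appμ k (bv i)    v = bv i
appμ k (lam t)   v = lam (appμ k t (ren suc idF v))
appμ k (app t u) v = app (appμ k t v) (appμ k u v)
appμ k (mu t)    v = mu (appμ (suc k) t (ren idF suc v))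
appμ k (nfv α t) v = nfv α (appμ k t v)
appμ k (nbv α t) v with α F.≟ k
... | yes _ = nbv α (app (appμ k t v) v)
... | no  _ = nbv α (appμ k t v)

-- abstraction of a free μ-variable name α: closeμ α k τ t turns free
-- occurrences (α w) into the bound index k
closeμ : ∀ {n m m'} → ℕ → Fin m' → (Fin m → Fin m') → Tm n m → Tm n m'
closeμ α k τ (fv x)    = fv x
closeμ α k τ (bv i)    = bv i
closeμ α k τ (lam t)   = lam (closeμ α k τ t)
closeμ α k τ (app t u) = app (closeμ α k τ t) (closeμ α k τ u)
closeμ α k τ (mu t)    = mu (closeμ α (suc k) (ext τ) t)
closeμ α k τ (nfv β t) with α N.≟ β
... | yes _ = nbv k (closeμ α k τ t)
... | no  _ = nfv β (closeμ α k τ t)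
closeμ α k τ (nbv β t) = nbv (τ β) (closeμ α k τ t)

muN : ∀ {n m} → ℕ → Tm n m → Tm n m
muN α u = mu (closeμ α zero suc u)

infix 4 _▷_ _▷*_

data _▷_ : ∀ {n m} → Tm n m → Tm n m → Set where
  βλ   : ∀ {n m} {u : Tm (suc n) m} {v : Tm n m} →
         app (lam u) v ▷ subst0 u v
  βμ   : ∀ {n m} {u : Tm n (suc m)} {v : Tm n m} →
         app (mu u) v ▷ mu (appμ zero u (ren idF suc v))
  ξlam : ∀ {n m} {t t' : Tm (suc n) m} → t ▷ t' → lam t ▷ lam t'
  ξapl : ∀ {n m} {t t' u : Tm n m} → t ▷ t' → app t u ▷ app t' u
  ξapr : ∀ {n m} {t u u' : Tm n m} → u ▷ u' → app t u ▷ app t u'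
  ξmu  : ∀ {n m} {t t' : Tm n (suc m)} → t ▷ t' → mu t ▷ mu t'
  ξnfv : ∀ {n m} {α} {t t' : Tm n m} → t ▷ t' → nfv α t ▷ nfv α t'
  ξnbv : ∀ {n m} {α} {t t' : Tm n m} → t ▷ t' → nbv α t ▷ nbv α t'

_▷*_ : Term → Term → Set
_▷*_ = Star _▷_

-- Types and typing (Γ, Δ type the bound λ- resp. μ-variables)

infixr 7 _⇒_

data Ty : Set where
  `_  : ℕ → Ty
  ⊥'  : Ty
  _⇒_ : Ty → Ty → Ty

infix 3 _⊢_∶_⨾_

data _⊢_∶_⨾_ : ∀ {n m} → Vec Ty n → Tm n m → Ty → Vec Ty m → Set where
  ax  : ∀ {n m} {Γ : Vec Ty n} {Δ : Vec Ty m} {i} →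
        Γ ⊢ bv i ∶ lookup Γ i ⨾ Δ
  →i  : ∀ {n m} {Γ : Vec Ty n} {Δ : Vec Ty m} {A B t} →
        (A ∷ Γ) ⊢ t ∶ B ⨾ Δ → Γ ⊢ lam t ∶ A ⇒ B ⨾ Δ
  →e  : ∀ {n m} {Γ : Vec Ty n} {Δ : Vec Ty m} {A B u v} →
        Γ ⊢ u ∶ A ⇒ B ⨾ Δ → Γ ⊢ v ∶ A ⨾ Δ → Γ ⊢ app u v ∶ B ⨾ Δ
  μr  : ∀ {n m} {Γ : Vec Ty n} {Δ : Vec Ty m} {A t} →
        Γ ⊢ t ∶ ⊥' ⨾ (A ∷ Δ) → Γ ⊢ mu t ∶ A ⨾ Δ
  ⊥r  : ∀ {n m} {Γ : Vec Ty n} {Δ : Vec Ty m} {k t} →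
        Γ ⊢ t ∶ lookup Δ k ⨾ Δ → Γ ⊢ nbv k t ∶ ⊥' ⨾ Δ

Saturated : Pred Term 0ℓ → Set
Saturated S = ∀ {u v} → v ▷* u → S u → S v

NonEmpty : Pred Term 0ℓ → Set
NonEmpty S = ∃ λ t → S t

infixr 5 _⇝_ _⇝ₛ_

_⇝_ : Pred Term 0ℓ → Pred Term 0ℓ → Pred Term 0ℓ
(K ⇝ L) t = ∀ u → K u → L (app t u)

appₛ : Term → List Term → Term
appₛ = foldl app

_⇝ₛ_ : Pred (List Term) 0ℓ → Pred Term 0ℓ → Pred Term 0ℓ
(X ⇝ₛ L) t = ∀ us → X us → L (appₛ t us)

-- sets of μ-variables: infinite = unbounded subset of ℕ
Infinite : Pred ℕ 0ℓ → Set
Infinite C = ∀ k → ∃ λ α → k ≤ α × C α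

record Model : Set₁ where
  field
    I     : Pred ℕ 0ℓ
    J     : Pred ℕ 0ℓ
    0∈I   : I 0
    C     : ℕ → Pred ℕ 0ℓ          -- C i, relevant for i ∈ I
    B     : ℕ → Pred Term 0ℓ       -- B i, relevant for i ∈ I
    R     : ℕ → Pred Term 0ℓ       -- R j, relevant for j ∈ J
    C-inf      : ∀ i → I i → Infinite (C i)
    C-disj     : ∀ i i' → I i → I i' → ∀ α → C i α → C i' α → i ≡ i'
    B-sat      : ∀ i → I i → Saturated (B i)
    B-ne       : ∀ i → I i → NonEmpty (B i)
    R-sat      : ∀ j → J j → Saturated (R j)
    R-ne       : ∀ j → J j → NonEmpty (R j)
    B-mu       : ∀ i → I i → ∀ α → C i α → ∀ u → B 0 u → B i (muN α u)
    B-name     : ∀ i → I i → ∀ α → C i α → ∀ u → B i u → B 0 (nfv α u)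
    R-form     : ∀ j → J j → Σ ℕ λ i → I i × Σ (Pred (List Term) 0ℓ) λ X →
                   ∀ t → ((R j t → (X ⇝ₛ B i) t) × ((X ⇝ₛ B i) t → R j t))

module _ (M : Model) where
  open Model M

  -- codes for the elements of |M| (smallest set containing the B_i, R_j
  -- and closed under ⇝)
  data Code : Set where
    cB   : ∀ i → I i → Code
    cR   : ∀ j → J j → Code
    _c⇝_ : Code → Code → Code

  ⟦_⟧c : Code → Pred Term 0ℓ
  ⟦ cB i _ ⟧c   = B i
  ⟦ cR j _ ⟧c   = R j
  ⟦ a c⇝ b ⟧c   = ⟦ a ⟧c ⇝ ⟦ b ⟧c

  Interp : Set
  Interp = ℕ → Code

  ⟦_⟧ty : Ty → Interp → Pred Term 0ℓ
  ⟦ ` X ⟧ty ℐ   = ⟦ ℐ X ⟧c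
  ⟦ ⊥' ⟧ty ℐ    = B 0
  ⟦ A ⇒ A' ⟧ty ℐ = ⟦ A ⟧ty ℐ ⇝ ⟦ A' ⟧ty ℐ

  ∣_∣[M] : Ty → Pred Term 0ℓ
  ∣ A ∣[M] t = ∀ ℐ → ⟦ A ⟧ty ℐ t

∣_∣ : Ty → Term → Set₁
∣ A ∣ t = ∀ (M : Model) → ∣_∣[M] M A t

module Submission where

-- Fix a model M and an interpretation ℐ, and write ⟦ A ⟧ for ℐ(A).  The
-- first semantic fact is that every ⟦ A ⟧ has the shape X ⇝ₛ B i for a
-- set of stacks X and an index i ∈ I (`represent`); saturation of ⟦ A ⟧
-- follows from it.  The theorem is then the closed case of an adequacy
-- statement for open derivations Γ ⊢ t ∶ A ⨾ Δ: we instantiate t by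
-- replacing each λ-variable x by a closed term of ⟦ Γ(x) ⟧, and each
-- μ-variable α : A' by a name β ∈ C i together with a stack s ∈ X, where
-- ⟦ A' ⟧ = X ⇝ₛ B i; a subterm (α w) becomes (β (w s)).  Syntactically,
-- the instantiation `inst` commutes with λ-substitution (`beta-inst`),
-- turns βμ-steps into growth of a stack (`mu-stack`) and turns closing a
-- fresh name back into a μ-binder (`close-inst`).

open import Defs
open import Level using (0ℓ)
open import Function using (_∘_)
open import Data.Nat as N using (ℕ; zero; suc; _≤_; _⊔_)
open import Data.Nat.Properties using (m≤m⊔n; m≤n⊔m; ≤-trans; <-irrefl)
open import Data.Fin as F using (Fin; zero; suc)
open import Data.Fin.Properties using (suc-injective)
open import Data.Vec using (Vec; []; lookup)
open import Data.Vec.Functional using () renaming (_∷_ to _∷ᶠ_)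
open import Data.List using (List; []; _∷_; foldl; map; _++_; [_])
open import Data.List.Properties using (++-assoc; ++-identityʳ)
open import Data.Sum using (_⊎_; inj₁; inj₂; map₁)
open import Data.Product using (Σ; ∃; _×_; _,_; proj₁; proj₂)
open import Data.Unit using (⊤; tt)
open import Data.Empty using (⊥; ⊥-elim)
open import Relation.Nullary using (¬_; yes; no)
open import Relation.Unary using (Pred)
open import Relation.Binary.PropositionalEquality
  using (_≡_; refl; sym; trans; cong; cong₂; subst; module ≡-Reasoning)
open import Relation.Binary.Construct.Closure.ReflexiveTransitive using (ε; _◅_; gmap)
open import Relation.Binary.Construct.Closure.ReflexiveTransitive.Properties
  using (module StarReasoning)

ext-cong : ∀ {n n'} {ρ ρ' : Fin n → Fin n'} → (∀ i → ρ i ≡ ρ' i) → ∀ i → ext ρ i ≡ ext ρ' i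
ext-cong h zero    = refl
ext-cong h (suc i) = cong suc (h i)

ren-cong : ∀ {n n' m m'} {ρ ρ' : Fin n → Fin n'} {τ τ' : Fin m → Fin m'} →
  (∀ i → ρ i ≡ ρ' i) → (∀ j → τ j ≡ τ' j) → ∀ t → ren ρ τ t ≡ ren ρ' τ' t
ren-cong h g (fv x)    = refl
ren-cong h g (bv i)    = cong bv (h i)
ren-cong h g (lam t)   = cong lam (ren-cong (ext-cong h) g t)
ren-cong h g (app t u) = cong₂ app (ren-cong h g t) (ren-cong h g u)
ren-cong h g (mu t)    = cong mu (ren-cong h (ext-cong g) t)
ren-cong h g (nfv α t) = cong (nfv α) (ren-cong h g t)
ren-cong h g (nbv α t) = cong₂ nbv (g α) (ren-cong h g t)

ext-id : ∀ {n} {ρ : Fin n → Fin n} → (∀ i → ρ i ≡ i) → ∀ i → ext ρ i ≡ i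
ext-id h zero    = refl
ext-id h (suc i) = cong suc (h i)

ren-id : ∀ {n m} {ρ : Fin n → Fin n} {τ : Fin m → Fin m} →
  (∀ i → ρ i ≡ i) → (∀ j → τ j ≡ j) → ∀ t → ren ρ τ t ≡ t
ren-id h g (fv x)    = refl
ren-id h g (bv i)    = cong bv (h i)
ren-id h g (lam t)   = cong lam (ren-id (ext-id h) g t)
ren-id h g (app t u) = cong₂ app (ren-id h g t) (ren-id h g u)
ren-id h g (mu t)    = cong mu (ren-id h (ext-id g) t)
ren-id h g (nfv α t) = cong (nfv α) (ren-id h g t)
ren-id h g (nbv α t) = cong₂ nbv (g α) (ren-id h g t)

ext-fuse : ∀ {a b c} {ρ : Fin b → Fin c} {ρ' : Fin a → Fin b} {ρ'' : Fin a → Fin c} →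
  (∀ i → ρ (ρ' i) ≡ ρ'' i) → ∀ i → ext ρ (ext ρ' i) ≡ ext ρ'' i
ext-fuse h zero    = refl
ext-fuse h (suc i) = cong suc (h i)

ren-fuse : ∀ {a b c a' b' c'} {ρ : Fin b → Fin c} {ρ' : Fin a → Fin b} {ρ'' : Fin a → Fin c}
  {τ : Fin b' → Fin c'} {τ' : Fin a' → Fin b'} {τ'' : Fin a' → Fin c'} →
  (∀ i → ρ (ρ' i) ≡ ρ'' i) → (∀ j → τ (τ' j) ≡ τ'' j) → ∀ t →
  ren ρ τ (ren ρ' τ' t) ≡ ren ρ'' τ'' t
ren-fuse h g (fv x)    = refl
ren-fuse h g (bv i)    = cong bv (h i)
ren-fuse h g (lam t)   = cong lam (ren-fuse (ext-fuse h) g t)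
ren-fuse h g (app t u) = cong₂ app (ren-fuse h g t) (ren-fuse h g u)
ren-fuse h g (mu t)    = cong mu (ren-fuse h (ext-fuse g) t)
ren-fuse h g (nfv α t) = cong (nfv α) (ren-fuse h g t)
ren-fuse h g (nbv α t) = cong₂ nbv (g α) (ren-fuse h g t)

wk : ∀ {n m} → Term → Tm n m
wk = ren (λ ()) (λ ())

wk-id : (c : Term) → wk c ≡ c
wk-id = ren-id (λ ()) (λ ())

wk-ren : ∀ {n m n' m'} (ρ : Fin n → Fin n') (τ : Fin m → Fin m') (c : Term) → ren ρ τ (wk c) ≡ wk c
wk-ren ρ τ = ren-fuse (λ ()) (λ ())

ren-closed : ∀ {n m} (ρ : Fin 0 → Fin n) (τ : Fin 0 → Fin m) (c : Term) → ren ρ τ c ≡ wk c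
ren-closed ρ τ = ren-cong (λ ()) (λ ())

sub-ren : ∀ {a n n' b m} {σ : Fin n → Tm n' m} {ρ : Fin a → Fin n} {ρ'' : Fin a → Fin n'}
  {τ : Fin b → Fin m} → (∀ i → σ (ρ i) ≡ bv (ρ'' i)) → ∀ t → sub σ (ren ρ τ t) ≡ ren ρ'' τ t
sub-ren h (fv x)    = refl
sub-ren h (bv i)    = h i
sub-ren {σ = σ} {ρ} {ρ''} h (lam t) = cong lam (sub-ren h' t)
  where
  h' : ∀ i → exts σ (ext ρ i) ≡ bv (ext ρ'' i)
  h' zero    = refl
  h' (suc i) = cong (ren suc idF) (h i)
sub-ren h (app t u) = cong₂ app (sub-ren h t) (sub-ren h u)
sub-ren h (mu t)    = cong mu (sub-ren (λ i → cong (ren idF suc) (h i)) t)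
sub-ren h (nfv α t) = cong (nfv α) (sub-ren h t)
sub-ren h (nbv α t) = cong (nbv _) (sub-ren h t)

sub-wk : ∀ {n n' m} {σ : Fin n → Tm n' m} (c : Term) → sub σ (wk {n} {m} c) ≡ wk c
sub-wk {σ = σ} = sub-ren {σ = σ} {ρ'' = λ ()} (λ ())

-- appμ k only acts on occurrences of k, so it fixes a renamed term
-- whose μ-renaming misses k.
appμ-ren : ∀ {a b n m} {ρ : Fin a → Fin n} {τ : Fin b → Fin m} (k : Fin m) →
  (∀ j → ¬ τ j ≡ k) → ∀ t v → appμ k (ren ρ τ t) v ≡ ren ρ τ t
appμ-ren k h (fv x)    v = refl
appμ-ren k h (bv i)    v = refl
appμ-ren k h (lam t)   v = cong lam (appμ-ren k h t _)
appμ-ren k h (app t u) v = cong₂ app (appμ-ren k h t v) (appμ-ren k h u v)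
appμ-ren {τ = τ} k h (mu t) v = cong mu (appμ-ren (suc k) h' t _)
  where
  h' : ∀ j → ¬ ext τ j ≡ suc k
  h' zero    ()
  h' (suc j) p = h j (suc-injective p)
appμ-ren k h (nfv α t) v = cong (nfv α) (appμ-ren k h t v)
appμ-ren {τ = τ} k h (nbv α t) v with τ α F.≟ k
... | yes p = ⊥-elim (h α p)
... | no _  = cong (nbv _) (appμ-ren k h t v)

appμ-wk : ∀ {n m} (k : Fin m) (c : Term) (v : Tm n m) → appμ k (wk c) v ≡ wk c
appμ-wk k = appμ-ren k (λ ())

-- Instantiation of bound variables

appStack : ∀ {n m} → Tm n m → List Term → Tm n m
appStack x s = foldl app x (map wk s)

appStack-closed : (x : Term) (s : List Term) → appStack x s ≡ appₛ x s
appStack-closed x []      = refl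
appStack-closed x (c ∷ s) = trans (cong (λ z → appStack (app x z) s) (wk-id c)) (appStack-closed (app x c) s)

appStack-snoc : ∀ {n m} (x : Tm n m) s c → appStack x (s ++ [ c ]) ≡ app (appStack x s) (wk c)
appStack-snoc x []      c = refl
appStack-snoc x (d ∷ s) c = appStack-snoc (app x (wk d)) s c

-- The image of a bound μ-variable: a bound μ-variable or a μ-name,
-- together with a stack; (α w) is instantiated to (α' (w ū)).
data Target (m : ℕ) : Set where
  bound : Fin m → List Term → Target m
  named : ℕ → List Term → Target m

jump : ∀ {n m} → Target m → Tm n m → Tm n m
jump (bound k s) x = nbv k (appStack x s)
jump (named α s) x = nfv α (appStack x s)

-- The image of a bound λ-variable is a bound λ-variable or a closed
-- term; both are invariant under the renamings needed below binders.
realize : ∀ {n m} → Fin n ⊎ Term → Tm n m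
realize (inj₁ k) = bv k
realize (inj₂ c) = wk c

liftλ : ∀ {n n'} → (Fin n → Fin n' ⊎ Term) → Fin (suc n) → Fin (suc n') ⊎ Term
liftλ σ = inj₁ zero ∷ᶠ map₁ suc ∘ σ

shift : ∀ {m} → Target m → Target (suc m)
shift (bound k s) = bound (suc k) s
shift (named α s) = named α s

liftμ : ∀ {m m'} → (Fin m → Target m') → Fin (suc m) → Target (suc m')
liftμ τ = bound zero [] ∷ᶠ shift ∘ τ

inst : ∀ {n n' m m'} → (Fin n → Fin n' ⊎ Term) → (Fin m → Target m') → Tm n m → Tm n' m'
inst σ τ (fv x)    = fv x
inst σ τ (bv i)    = realize (σ i)
inst σ τ (lam t)   = lam (inst (liftλ σ) τ t)
inst σ τ (app t u) = app (inst σ τ t) (inst σ τ u)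
inst σ τ (mu t)    = mu (inst σ (liftμ τ) t)
inst σ τ (nfv α t) = nfv α (inst σ τ t)
inst σ τ (nbv j t) = jump (τ j) (inst σ τ t)

inst-id : ∀ {n m} (σ : Fin n → Fin n ⊎ Term) (τ : Fin m → Target m) →
  (∀ i → σ i ≡ inj₁ i) → (∀ j → τ j ≡ bound j []) → ∀ t → inst σ τ t ≡ t
inst-id σ τ h g (fv x)    = refl
inst-id σ τ h g (bv i)    = cong realize (h i)
inst-id σ τ h g (lam t)   = cong lam (inst-id (liftλ σ) τ h' g t)
  where
  h' : ∀ i → liftλ σ i ≡ inj₁ i
  h' zero    = refl
  h' (suc i) = cong (map₁ suc) (h i)
inst-id σ τ h g (app t u) = cong₂ app (inst-id σ τ h g t) (inst-id σ τ h g u)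
inst-id σ τ h g (mu t)    = cong mu (inst-id σ (liftμ τ) h g' t)
  where
  g' : ∀ j → liftμ τ j ≡ bound j []
  g' zero    = refl
  g' (suc j) = cong shift (g j)
inst-id σ τ h g (nfv α t) = cong (nfv α) (inst-id σ τ h g t)
inst-id σ τ h g (nbv j t) = cong₂ jump (g j) (inst-id σ τ h g t)

sub-appStack : ∀ {n n' m} (ρ : Fin n → Tm n' m) x s → sub ρ (appStack x s) ≡ appStack (sub ρ x) s
sub-appStack ρ x []      = refl
sub-appStack ρ x (c ∷ s) =
  trans (sub-appStack ρ (app x (wk c)) s) (cong (λ z → appStack (app (sub ρ x) z) s) (sub-wk c))

sub-jump : ∀ {n n' m} (ρ : Fin n → Tm n' m) g x → sub ρ (jump g x) ≡ jump g (sub ρ x)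
sub-jump ρ (bound k s) x = cong (nbv k) (sub-appStack ρ x s)
sub-jump ρ (named α s) x = cong (nfv α) (sub-appStack ρ x s)

realize-liftλ : ∀ {n m} (y : Fin n ⊎ Term) → ren suc idF (realize {n} {m} y) ≡ realize (map₁ suc y)
realize-liftλ (inj₁ k) = refl
realize-liftλ (inj₂ c) = wk-ren suc idF c

realize-liftμ : ∀ {n m} (y : Fin n ⊎ Term) → ren idF suc (realize {n} {m} y) ≡ realize y
realize-liftμ (inj₁ k) = refl
realize-liftμ (inj₂ c) = wk-ren idF suc c

sub-realize-liftλ : ∀ {n n' m} (ρ : Fin n → Tm n' m) (y : Fin n ⊎ Term) →
  sub (exts ρ) (realize (map₁ suc y)) ≡ ren suc idF (sub ρ (realize y))
sub-realize-liftλ ρ (inj₁ k) = refl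
sub-realize-liftλ ρ (inj₂ c) = begin
  sub (exts ρ) (wk c)          ≡⟨ sub-wk c ⟩
  wk c                         ≡⟨ sym (wk-ren suc idF c) ⟩
  ren suc idF (wk c)           ≡⟨ cong (ren suc idF) (sym (sub-wk c)) ⟩
  ren suc idF (sub ρ (wk c))   ∎
  where open ≡-Reasoning

sub-realize-liftμ : ∀ {n n' m} (ρ : Fin n → Tm n' m) (y : Fin n ⊎ Term) →
  sub (λ i → ren idF suc (ρ i)) (realize y) ≡ ren idF suc (sub ρ (realize y))
sub-realize-liftμ ρ (inj₁ k) = refl
sub-realize-liftμ ρ (inj₂ c) = begin
  sub _ (wk c)                 ≡⟨ sub-wk c ⟩
  wk c                         ≡⟨ sym (wk-ren idF suc c) ⟩
  ren idF suc (wk c)           ≡⟨ cong (ren idF suc) (sym (sub-wk c)) ⟩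
  ren idF suc (sub ρ (wk c))   ∎
  where open ≡-Reasoning

sub-inst : ∀ {n n' n'' m m'} (σ : Fin n → Fin n' ⊎ Term) (σ' : Fin n → Fin n'' ⊎ Term)
  (ρ : Fin n' → Tm n'' m') (τ : Fin m → Target m') →
  (∀ i → sub ρ (realize (σ i)) ≡ realize (σ' i)) → ∀ t → sub ρ (inst σ τ t) ≡ inst σ' τ t
sub-inst σ σ' ρ τ h (fv x)    = refl
sub-inst σ σ' ρ τ h (bv i)    = h i
sub-inst σ σ' ρ τ h (lam t)   = cong lam (sub-inst (liftλ σ) (liftλ σ') (exts ρ) τ h' t)
  where
  open ≡-Reasoning
  h' : ∀ i → sub (exts ρ) (realize (liftλ σ i)) ≡ realize (liftλ σ' i)
  h' zero    = refl
  h' (suc i) = begin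
    sub (exts ρ) (realize (map₁ suc (σ i)))  ≡⟨ sub-realize-liftλ ρ (σ i) ⟩
    ren suc idF (sub ρ (realize (σ i)))      ≡⟨ cong (ren suc idF) (h i) ⟩
    ren suc idF (realize (σ' i))             ≡⟨ realize-liftλ (σ' i) ⟩
    realize (map₁ suc (σ' i))                ∎
sub-inst σ σ' ρ τ h (app t u) = cong₂ app (sub-inst σ σ' ρ τ h t) (sub-inst σ σ' ρ τ h u)
sub-inst σ σ' ρ τ h (mu t)    = cong mu (sub-inst σ σ' (λ i → ren idF suc (ρ i)) (liftμ τ) h' t)
  where
  open ≡-Reasoning
  h' : ∀ i → sub (λ i → ren idF suc (ρ i)) (realize (σ i)) ≡ realize (σ' i)
  h' i = begin
    sub (λ i → ren idF suc (ρ i)) (realize (σ i))  ≡⟨ sub-realize-liftμ ρ (σ i) ⟩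
    ren idF suc (sub ρ (realize (σ i)))            ≡⟨ cong (ren idF suc) (h i) ⟩
    ren idF suc (realize (σ' i))                   ≡⟨ realize-liftμ (σ' i) ⟩
    realize (σ' i)                                 ∎
sub-inst σ σ' ρ τ h (nfv α t) = cong (nfv α) (sub-inst σ σ' ρ τ h t)
sub-inst σ σ' ρ τ h (nbv j t) = trans (sub-jump ρ (τ j) _) (cong (jump (τ j)) (sub-inst σ σ' ρ τ h t))

beta-inst : ∀ {n m} (σ : Fin n → Term) (τ : Fin m → Target 0) (t : Tm (suc n) m) (u : Term) →
  subst0 (inst (liftλ (inj₂ ∘ σ)) τ t) u ≡ inst (inj₂ ∘ (u ∷ᶠ σ)) τ t
beta-inst σ τ t u = sub-inst (liftλ (inj₂ ∘ σ)) (inj₂ ∘ (u ∷ᶠ σ)) _ τ images t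
  where
  images : ∀ i → _ ≡ realize (inj₂ ((u ∷ᶠ σ) i))
  images zero    = sym (wk-id u)
  images (suc i) = sub-wk (σ i)

data Extends {m} (k : Fin m) (c : Term) : Target m → Target m → Set where
  hit   : ∀ {s} → Extends k c (bound k s) (bound k (s ++ [ c ]))
  miss  : ∀ {j s} → ¬ j ≡ k → Extends k c (bound j s) (bound j s)
  named : ∀ {β s} → Extends k c (named β s) (named β s)

shift-extends : ∀ {m} {k : Fin m} {c} {g g'} → Extends k c g g' → Extends (suc k) c (shift g) (shift g')
shift-extends hit      = hit
shift-extends (miss q) = miss (q ∘ suc-injective)
shift-extends named    = named

appμ-appStack : ∀ {n m} (k : Fin m) (x v : Tm n m) s → appμ k (appStack x s) v ≡ appStack (appμ k x v) s
appμ-appStack k x v []      = refl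
appμ-appStack k x v (c ∷ s) =
  trans (appμ-appStack k (app x (wk c)) v s) (cong (λ z → appStack (app (appμ k x v) z) s) (appμ-wk k c v))

appμ-realize : ∀ {n m} (k : Fin m) y (v : Tm n m) → appμ k (realize y) v ≡ realize y
appμ-realize k (inj₁ i) v = refl
appμ-realize k (inj₂ c) v = appμ-wk k c v

appμ-jump : ∀ {n m} (k : Fin m) (c : Term) {g g'} → Extends k c g g' → ∀ (x y v : Tm n m) →
  appμ k x v ≡ y → v ≡ wk c → appμ k (jump g x) v ≡ jump g' y
appμ-jump k c (hit {s}) x y v e ev with k F.≟ k
... | no k≢k = ⊥-elim (k≢k refl)
... | yes _  = cong (nbv k) (begin
  app (appμ k (appStack x s) v) v       ≡⟨ cong₂ app (appμ-appStack k x v s) ev ⟩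
  app (appStack (appμ k x v) s) (wk c)  ≡⟨ cong (λ z → app (appStack z s) (wk c)) e ⟩
  app (appStack y s) (wk c)             ≡⟨ sym (appStack-snoc y s c) ⟩
  appStack y (s ++ [ c ])               ∎)
  where open ≡-Reasoning
appμ-jump k c (miss {j} {s} j≢k) x y v e ev with j F.≟ k
... | yes j≡k = ⊥-elim (j≢k j≡k)
... | no _    = cong (nbv j) (trans (appμ-appStack k x v s) (cong (λ z → appStack z s) e))
appμ-jump k c (named {β} {s}) x y v e ev =
  cong (nfv β) (trans (appμ-appStack k x v s) (cong (λ z → appStack z s) e))

appμ-inst : ∀ {n n' m m'} (σ : Fin n → Fin n' ⊎ Term) (τ τ' : Fin m → Target m') (k : Fin m') (c : Term) →
  (∀ j → Extends k c (τ j) (τ' j)) → ∀ t v → v ≡ wk c → appμ k (inst σ τ t) v ≡ inst σ τ' t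
appμ-inst σ τ τ' k c r (fv x)    v e = refl
appμ-inst σ τ τ' k c r (bv i)    v e = appμ-realize k (σ i) v
appμ-inst σ τ τ' k c r (lam t)   v e =
  cong lam (appμ-inst (liftλ σ) τ τ' k c r t (ren suc idF v) (trans (cong (ren suc idF) e) (wk-ren suc idF c)))
appμ-inst σ τ τ' k c r (app t u) v e = cong₂ app (appμ-inst σ τ τ' k c r t v e) (appμ-inst σ τ τ' k c r u v e)
appμ-inst σ τ τ' k c r (mu t)    v e =
  cong mu (appμ-inst σ (liftμ τ) (liftμ τ') (suc k) c r' t (ren idF suc v)
                     (trans (cong (ren idF suc) e) (wk-ren idF suc c)))
  where
  r' : ∀ j → Extends (suc k) c (liftμ τ j) (liftμ τ' j)
  r' zero    = miss (λ ())
  r' (suc j) = shift-extends (r j)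
appμ-inst σ τ τ' k c r (nfv α t) v e = cong (nfv α) (appμ-inst σ τ τ' k c r t v e)
appμ-inst σ τ τ' k c r (nbv j t) v e =
  appμ-jump k c (r j) (inst σ τ t) (inst σ τ' t) v (appμ-inst σ τ τ' k c r t v e) e

appₛ-star : ∀ {x y : Term} us → x ▷* y → appₛ x us ▷* appₛ y us
appₛ-star []       rs = rs
appₛ-star (u ∷ us) rs = appₛ-star us (gmap (λ z → app z u) ξapl rs)

-- The stack of the outermost μ-binder, seen from inside it.
outer : ∀ {m} → List Term → (Fin m → Target 0) → Fin (suc m) → Target 1
outer s τ = bound zero s ∷ᶠ shift ∘ τ

mu-stack : ∀ {n m} (σ : Fin n → Fin 0 ⊎ Term) (τ : Fin m → Target 0) (t : Tm n (suc m)) (s us : List Term) →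
  appₛ (mu (inst σ (outer s τ) t)) us ▷* mu (inst σ (outer (s ++ us) τ) t)
mu-stack σ τ t s [] = begin
  mu (inst σ (outer s τ) t)         ≡⟨ cong (λ s' → mu (inst σ (outer s' τ) t)) (sym (++-identityʳ s)) ⟩
  mu (inst σ (outer (s ++ []) τ) t) ∎
  where open StarReasoning _▷_
mu-stack σ τ t s (c ∷ us) = begin
  appₛ (app (mu (inst σ (outer s τ) t)) c) us                          ⟶*⟨ appₛ-star us (βμ ◅ ε) ⟩
  appₛ (mu (appμ zero (inst σ (outer s τ) t) (ren idF suc c))) us       ≡⟨ cong (λ z → appₛ (mu z) us) push ⟩
  appₛ (mu (inst σ (outer (s ++ [ c ]) τ) t)) us                        ⟶*⟨ mu-stack σ τ t (s ++ [ c ]) us ⟩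
  mu (inst σ (outer ((s ++ [ c ]) ++ us) τ) t)                         ≡⟨ cong (λ s' → mu (inst σ (outer s' τ) t)) (++-assoc s [ c ] us) ⟩
  mu (inst σ (outer (s ++ c ∷ us) τ) t)                                ∎
  where
  open StarReasoning _▷_
  extends : ∀ j → Extends zero c (outer s τ j) (outer (s ++ [ c ]) τ j)
  extends zero    = hit
  extends (suc j) with τ j
  ... | named β s' = named
  push : appμ zero (inst σ (outer s τ) t) (ren idF suc c) ≡ inst σ (outer (s ++ [ c ]) τ) t
  push = appμ-inst σ _ _ zero c extends t (ren idF suc c) (ren-closed idF suc c)

Fresh : ∀ {n m} → ℕ → Tm n m → Set
Fresh α (fv x)    = ⊤
Fresh α (bv i)    = ⊤
Fresh α (lam t)   = Fresh α t
Fresh α (app t u) = Fresh α t × Fresh α u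
Fresh α (mu t)    = Fresh α t
Fresh α (nfv β t) = ¬ α ≡ β × Fresh α t
Fresh α (nbv β t) = Fresh α t

fresh-bound : ∀ {n m} (t : Tm n m) → Σ ℕ λ N → ∀ α → N ≤ α → Fresh α t
fresh-bound (fv x)    = 0 , λ _ _ → tt
fresh-bound (bv i)    = 0 , λ _ _ → tt
fresh-bound (lam t)   = fresh-bound t
fresh-bound (app t u) with fresh-bound t | fresh-bound u
... | N₁ , f₁ | N₂ , f₂ =
  N₁ ⊔ N₂ , λ α le → f₁ α (≤-trans (m≤m⊔n N₁ N₂) le) , f₂ α (≤-trans (m≤n⊔m N₁ N₂) le)
fresh-bound (mu t)    = fresh-bound t
fresh-bound (nfv β t) with fresh-bound t
... | N , f = suc β ⊔ N , λ α le →
  (λ α≡β → <-irrefl (sym α≡β) (≤-trans (m≤m⊔n (suc β) N) le)) , f α (≤-trans (m≤n⊔m (suc β) N) le)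
fresh-bound (nbv β t) = fresh-bound t

fresh-name : ∀ {n m} {C : Pred ℕ 0ℓ} → Infinite C → (t : Tm n m) → ∃ λ α → C α × Fresh α t
fresh-name inf t with fresh-bound t
... | N , fresh with inf N
...   | α , N≤α , α∈C = α , α∈C , fresh α N≤α

fresh-ren : ∀ {α a b n m a' b'} {f : Fin a → Fin n} {g : Fin b → Fin m} {f' : Fin a → Fin a'}
  {g' : Fin b → Fin b'} (t : Tm a b) → Fresh α (ren f' g' t) → Fresh α (ren f g t)
fresh-ren (fv x)    fr          = tt
fresh-ren (bv i)    fr          = tt
fresh-ren (lam t)   fr          = fresh-ren t fr
fresh-ren (app t u) (fr₁ , fr₂) = fresh-ren t fr₁ , fresh-ren u fr₂
fresh-ren (mu t)    fr          = fresh-ren t fr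
fresh-ren (nfv β t) (α≢β , fr)  = α≢β , fresh-ren t fr
fresh-ren (nbv β t) fr          = fresh-ren t fr

closeμ-fresh : ∀ {n m m'} (α : ℕ) (k : Fin m') (ρ : Fin m → Fin m') {f : Fin n → Fin n} →
  (∀ i → f i ≡ i) → ∀ x → Fresh α x → closeμ α k ρ x ≡ ren f ρ x
closeμ-fresh α k ρ h (fv x)    fr          = refl
closeμ-fresh α k ρ h (bv i)    fr          = cong bv (sym (h i))
closeμ-fresh α k ρ h (lam x)   fr          = cong lam (closeμ-fresh α k ρ (ext-id h) x fr)
closeμ-fresh α k ρ h (app x y) (fr₁ , fr₂) = cong₂ app (closeμ-fresh α k ρ h x fr₁) (closeμ-fresh α k ρ h y fr₂)
closeμ-fresh α k ρ h (mu x)    fr          = cong mu (closeμ-fresh α (suc k) (ext ρ) h x fr)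
closeμ-fresh α k ρ h (nfv β x) (α≢β , fr) with α N.≟ β
... | yes α≡β = ⊥-elim (α≢β α≡β)
... | no _    = cong (nfv β) (closeμ-fresh α k ρ h x fr)
closeμ-fresh α k ρ h (nbv β x) fr          = cong (nbv (ρ β)) (closeμ-fresh α k ρ h x fr)

closeμ-wk : ∀ {n m m'} (α : ℕ) (k : Fin m') (ρ : Fin m → Fin m') (c : Term) →
  Fresh α (wk {n} {m'} c) → closeμ α k ρ (wk {n} {m} c) ≡ wk c
closeμ-wk α k ρ c fr = trans (closeμ-fresh α k ρ (λ i → refl) (wk c) (fresh-ren c fr)) (wk-ren idF ρ c)

fresh-appStack-head : ∀ {n m} {α} (x : Tm n m) s → Fresh α (appStack x s) → Fresh α x
fresh-appStack-head x []      fr = fr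
fresh-appStack-head x (c ∷ s) fr = proj₁ (fresh-appStack-head (app x (wk c)) s fr)

closeμ-appStack : ∀ {n m m'} (α : ℕ) (k : Fin m') (ρ : Fin m → Fin m') s (x : Tm n m) (y : Tm n m') →
  Fresh α (appStack y s) → closeμ α k ρ x ≡ y → closeμ α k ρ (appStack x s) ≡ appStack y s
closeμ-appStack α k ρ []      x y fr e = e
closeμ-appStack α k ρ (c ∷ s) x y fr e =
  closeμ-appStack α k ρ s (app x (wk c)) (app y (wk c)) fr
    (cong₂ app e (closeμ-wk α k ρ c (proj₂ (fresh-appStack-head (app y (wk c)) s fr))))

data Closes {m m'} (α : ℕ) (k : Fin m') (ρ : Fin m → Fin m') : Target m → Target m' → Set where
  hit   : ∀ {s} → Closes α k ρ (named α s) (bound k s)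
  other : ∀ {β s} → Closes α k ρ (named β s) (named β s)
  bound : ∀ {j s} → Closes α k ρ (bound j s) (bound (ρ j) s)

shift-closes : ∀ {m m'} {α} {k : Fin m'} {ρ : Fin m → Fin m'} {g g'} → Closes α k ρ g g' →
  Closes α (suc k) (ext ρ) (shift g) (shift g')
shift-closes hit   = hit
shift-closes other = other
shift-closes bound = bound

fresh-jump-body : ∀ {n m} {α} g (y : Tm n m) → Fresh α (jump g y) → Fresh α y
fresh-jump-body (bound k s) y fr = fresh-appStack-head y s fr
fresh-jump-body (named β s) y fr = fresh-appStack-head y s (proj₂ fr)

closeμ-jump : ∀ {n m m'} (α : ℕ) (k : Fin m') (ρ : Fin m → Fin m') {g g'} → Closes α k ρ g g' →
  ∀ (x : Tm n m) y → Fresh α (jump g' y) → closeμ α k ρ x ≡ y → closeμ α k ρ (jump g x) ≡ jump g' y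
closeμ-jump α k ρ (hit {s}) x y fr e with α N.≟ α
... | yes _   = cong (nbv k) (closeμ-appStack α k ρ s x y fr e)
... | no α≢α  = ⊥-elim (α≢α refl)
closeμ-jump α k ρ (other {β} {s}) x y (α≢β , fr) e with α N.≟ β
... | yes α≡β = ⊥-elim (α≢β α≡β)
... | no _    = cong (nfv β) (closeμ-appStack α k ρ s x y fr e)
closeμ-jump α k ρ (bound {j} {s}) x y fr e = cong (nbv (ρ j)) (closeμ-appStack α k ρ s x y fr e)

closeμ-realize : ∀ {n m m'} (α : ℕ) (k : Fin m') (ρ : Fin m → Fin m') (y : Fin n ⊎ Term) →
  Fresh α (realize {n} {m'} y) → closeμ α k ρ (realize y) ≡ realize y
closeμ-realize α k ρ (inj₁ i) fr = refl
closeμ-realize α k ρ (inj₂ c) fr = closeμ-wk α k ρ c fr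

close-inst : ∀ {n n' p m m'} (σ : Fin n → Fin n' ⊎ Term) (τ : Fin p → Target m) (τ' : Fin p → Target m')
  (α : ℕ) (k : Fin m') (ρ : Fin m → Fin m') →
  (∀ j → Closes α k ρ (τ j) (τ' j)) → ∀ t → Fresh α (inst σ τ' t) → closeμ α k ρ (inst σ τ t) ≡ inst σ τ' t
close-inst σ τ τ' α k ρ r (fv x)    fr          = refl
close-inst σ τ τ' α k ρ r (bv i)    fr          = closeμ-realize α k ρ (σ i) fr
close-inst σ τ τ' α k ρ r (lam t)   fr          = cong lam (close-inst (liftλ σ) τ τ' α k ρ r t fr)
close-inst σ τ τ' α k ρ r (app t u) (fr₁ , fr₂) =
  cong₂ app (close-inst σ τ τ' α k ρ r t fr₁) (close-inst σ τ τ' α k ρ r u fr₂)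
close-inst σ τ τ' α k ρ r (mu t)    fr          =
  cong mu (close-inst σ (liftμ τ) (liftμ τ') α (suc k) (ext ρ) r' t fr)
  where
  r' : ∀ j → Closes α (suc k) (ext ρ) (liftμ τ j) (liftμ τ' j)
  r' zero    = bound
  r' (suc j) = shift-closes (r j)
close-inst σ τ τ' α k ρ r (nfv β t) (α≢β , fr) with α N.≟ β
... | yes α≡β = ⊥-elim (α≢β α≡β)
... | no _    = cong (nfv β) (close-inst σ τ τ' α k ρ r t fr)
close-inst σ τ τ' α k ρ r (nbv j t) fr =
  closeμ-jump α k ρ (r j) (inst σ τ t) (inst σ τ' t) fr
    (close-inst σ τ τ' α k ρ r t (fresh-jump-body (τ' j) (inst σ τ' t) fr))

mu-named : ∀ {n m} (σ : Fin n → Fin 0 ⊎ Term) (τ : Fin m → Target 0) (t : Tm n (suc m)) (s : List Term) (β : ℕ) →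
  Fresh β (inst σ (outer s τ) t) → muN β (inst σ (named β s ∷ᶠ τ) t) ≡ mu (inst σ (outer s τ) t)
mu-named σ τ t s β fr = cong mu (close-inst σ _ _ β zero suc closes t fr)
  where
  closes : ∀ j → Closes β zero suc ((named β s ∷ᶠ τ) j) (outer s τ j)
  closes zero    = hit
  closes (suc j) with τ j
  ... | named γ s' = other

-- Every element of |M| is of the form X ⇝ₛ B i

module Representations (M : Model) where
  open Model M

  record Representation (P : Pred Term 0ℓ) : Set₁ where
    field
      index   : ℕ
      index∈I : I index
      stacks  : Pred (List Term) 0ℓ
      to      : ∀ {t} → P t → (stacks ⇝ₛ B index) t
      from    : ∀ {t} → (stacks ⇝ₛ B index) t → P t

  open Representation public

  represent-B : ∀ i → I i → Representation (B i)
  represent-B i i∈I = record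
    { index = i ; index∈I = i∈I ; stacks = λ us → us ≡ []
    ; to = λ { Bt .[] refl → Bt } ; from = λ h → h [] refl }

  represent-R : ∀ j → J j → Representation (R j)
  represent-R j j∈J with R-form j j∈J
  ... | i , i∈I , X , equiv = record
    { index = i ; index∈I = i∈I ; stacks = X
    ; to = λ {t} → proj₁ (equiv t) ; from = λ {t} → proj₂ (equiv t) }

  _∷ₚ_ : Pred Term 0ℓ → Pred (List Term) 0ℓ → Pred (List Term) 0ℓ
  (K ∷ₚ X) []       = ⊥
  (K ∷ₚ X) (u ∷ us) = K u × X us

  represent-⇝ : ∀ K {L} → Representation L → Representation (K ⇝ L)
  represent-⇝ K ρ = record
    { index = index ρ ; index∈I = index∈I ρ ; stacks = K ∷ₚ stacks ρ
    ; to   = λ { h (u ∷ us) (u∈K , us∈X) → to ρ (h u u∈K) us us∈X }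
    ; from = λ h u u∈K → from ρ (λ us us∈X → h (u ∷ us) (u∈K , us∈X)) }

  represent-code : (c : Code M) → Representation (⟦_⟧c M c)
  represent-code (cB i i∈I) = represent-B i i∈I
  represent-code (cR j j∈J) = represent-R j j∈J
  represent-code (a c⇝ b)   = represent-⇝ _ (represent-code b)

  -- A represented set is saturated, since each B i is.
  represented-saturated : ∀ {P} → Representation P → Saturated P
  represented-saturated ρ v▷*u Pu =
    from ρ λ us us∈X → B-sat (index ρ) (index∈I ρ) (appₛ-star us v▷*u) (to ρ Pu us us∈X)

-- Adequacy of the typing rules

module Adequacy (M : Model) (ℐ : Interp M) where
  open Model M
  open Representations M

  ⟦_⟧ : Ty → Pred Term 0ℓ
  ⟦ A ⟧ = ⟦_⟧ty M A ℐ

  represent : (A : Ty) → Representation ⟦ A ⟧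
  represent (` X)    = represent-code (ℐ X)
  represent ⊥'       = represent-B 0 0∈I
  represent (A ⇒ A') = represent-⇝ ⟦ A ⟧ (represent A')

  -- A μ-variable of type A may be instantiated by a name of the sort
  -- of ⟦ A ⟧ with a stack from its set of stacks.
  data Admissible (A : Ty) : Target 0 → Set where
    admissible : ∀ {β s} → C (index (represent A)) β → stacks (represent A) s → Admissible A (named β s)

  -- (→i) is sound: by saturation, a λ-abstraction whose body maps K into
  -- L after each β-step is in K ⇝ L.
  lam-rule : ∀ {n m} {K L : Pred Term 0ℓ} → Saturated L →
    (σ : Fin n → Term) (τ : Fin m → Target 0) (t : Tm (suc n) m) →
    (∀ u → K u → L (inst (inj₂ ∘ (u ∷ᶠ σ)) τ t)) → (K ⇝ L) (lam (inst (liftλ (inj₂ ∘ σ)) τ t))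
  lam-rule {L = L} sat σ τ t body u u∈K = sat (βλ ◅ ε) (subst L (sym (beta-inst σ τ t u)) (body u u∈K))

  -- (μ) is sound: applied to a stack ū ∈ X, the μ-abstraction reduces to
  -- μβ.t' with β ∈ C i fresh and t' the body for the target (β ū),
  -- which is in B i by the definition of a model.
  mu-rule : ∀ {n m} {P} (ρ : Representation P) (σ : Fin n → Term) (τ : Fin m → Target 0)
    (t : Tm n (suc m)) →
    (∀ β vs → C (index ρ) β → stacks ρ vs → B 0 (inst (inj₂ ∘ σ) (named β vs ∷ᶠ τ) t)) →
    P (mu (inst (inj₂ ∘ σ) (liftμ τ) t))
  mu-rule ρ σ τ t body = from ρ λ vs vs∈X →
    let i = index ρ ; i∈I = index∈I ρ
        β , β∈C , fresh = fresh-name (C-inf i i∈I) (inst (inj₂ ∘ σ) (outer vs τ) t)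
        named-body = B-mu i i∈I β β∈C _ (body β vs β∈C vs∈X)
    in B-sat i i∈I (mu-stack (inj₂ ∘ σ) τ t [] vs)
         (subst (B i) (mu-named (inj₂ ∘ σ) τ t vs β fresh) named-body)

  -- (⊥) is sound: for an admissible target (β ū), a term x ∈ ⟦ A ⟧ gives
  -- (x ū) ∈ B i, hence (β (x ū)) ∈ B 0.
  jump-rule : ∀ {A g} {x : Term} → Admissible A g → ⟦ A ⟧ x → B 0 (jump g x)
  jump-rule {A} {named β s} {x} (admissible β∈C s∈X) x∈A =
    B-name (index ρ) (index∈I ρ) β β∈C _ (subst (B (index ρ)) (sym (appStack-closed x s)) (to ρ x∈A s s∈X))
    where ρ = represent A

  adequacy : ∀ {n m} {Γ : Vec Ty n} {Δ : Vec Ty m} {t A} → Γ ⊢ t ∶ A ⨾ Δ →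
    (σ : Fin n → Term) → (∀ i → ⟦ lookup Γ i ⟧ (σ i)) →
    (τ : Fin m → Target 0) → (∀ j → Admissible (lookup Δ j) (τ j)) →
    ⟦ A ⟧ (inst (inj₂ ∘ σ) τ t)
  adequacy {Γ = Γ} (ax {i = i}) σ σ-ok τ τ-ok = subst ⟦ lookup Γ i ⟧ (sym (wk-id (σ i))) (σ-ok i)
  adequacy (→i {B = A'} {t = t} d) σ σ-ok τ τ-ok =
    lam-rule (represented-saturated (represent A')) σ τ t
      λ u u∈A → adequacy d (u ∷ᶠ σ) (λ { zero → u∈A ; (suc i) → σ-ok i }) τ τ-ok
  adequacy (→e d e) σ σ-ok τ τ-ok = adequacy d σ σ-ok τ τ-ok _ (adequacy e σ σ-ok τ τ-ok)
  adequacy (μr {A = A} {t = t} d) σ σ-ok τ τ-ok =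
    mu-rule (represent A) σ τ t λ β vs β∈C vs∈X →
      adequacy d σ σ-ok (named β vs ∷ᶠ τ) λ { zero → admissible β∈C vs∈X ; (suc j) → τ-ok j }
  adequacy (⊥r {k = k} d) σ σ-ok τ τ-ok = jump-rule (τ-ok k) (adequacy d σ σ-ok τ τ-ok)

-- Corollary 2.19: a closed term is its own instantiation with empty
-- contexts, so adequacy applies in every model and interpretation.
corollary2p19 : ∀ (A : Ty) (t : Term) → [] ⊢ t ∶ A ⨾ [] → ∣ A ∣ t
corollary2p19 A t d M ℐ =
  subst (⟦_⟧ty M A ℐ) (inst-id _ _ (λ ()) (λ ()) t) (adequacy d (λ ()) (λ ()) (λ ()) (λ ()))
  where open Adequacy M ℐ
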